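{- Let $\iota$ be an involution of $[n]$ avoiding the pattern $321$, and let its two-cycles be $(s_1,t_1),\dots,(s_m,t_m)$ with $s_i<t_i$ for all $i$. If $(a,b)$ is an inversion of $\iota$, then $a=s_i$ and $b=t_j$ for some $i,j$. Moreover, $$\mathrm{inv}(\iota)=\sum_{i=1}^m (t_i-s_i).$$
   Context: A permutation $\sigma$ of $[n]$ (one-line notation) contains a pattern $\pi\in\mathfrak{S}_k$ if some subsequence $\sigma(m_1)\cdots\sigma(m_k)$ with $m_1<\dots<m_k$ is in the same relative order as $\pi$; otherwise it avoids $\pi$. An involution is a permutation with $\iota^2=\mathrm{id}$; its two-cycles are the pairs $\{i,\iota(i)\}$ with $\iota(i)\neq i$. An inversion of $\sigma$ is a pair $(i,j)$ with $i<j$ and $\sigma(i)>\sigma(j)$; $\mathrm{inv}(\sigma)$ is the number of inversions. -}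

module Defs where

open import Data.Nat using (ℕ; _∸_)
open import Data.Fin using (Fin; toℕ; _<_; _<?_)
open import Data.Fin.Permutation using (Permutation′; _⟨$⟩ʳ_)
open import Data.List using (List; allFin; concatMap; map; filter; length; _∷_; [])
open import Data.Nat.ListAction using (sum)
open import Data.Product using (_×_; _,_; ∃; ∃-syntax)
open import Relation.Binary.PropositionalEquality using (_≡_)
open import Relation.Nullary using (¬_)
open import Relation.Nullary.Decidable using (_×-dec_)

IsInvolution : ∀ {n} → Permutation′ n → Set
IsInvolution {n} ι = ∀ (i : Fin n) → ι ⟨$⟩ʳ (ι ⟨$⟩ʳ i) ≡ i

Contains321 : ∀ {n} → Permutation′ n → Set
Contains321 {n} σ =
  ∃[ i ] ∃[ j ] ∃[ k ] (i < j × j < k ×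
     σ ⟨$⟩ʳ j < σ ⟨$⟩ʳ i × σ ⟨$⟩ʳ k < σ ⟨$⟩ʳ j)

Avoids321 : ∀ {n} → Permutation′ n → Set
Avoids321 σ = ¬ Contains321 σ

IsInversion : ∀ {n} → Permutation′ n → Fin n → Fin n → Set
IsInversion σ a b = a < b × σ ⟨$⟩ʳ b < σ ⟨$⟩ʳ a

allPairs : ∀ n → List (Fin n × Fin n)
allPairs n = concatMap (λ a → map (λ b → (a , b)) (allFin n)) (allFin n)

inv : ∀ {n} → Permutation′ n → ℕ
inv {n} σ = length (filter (λ p → let (a , b) = p in
                                     (a <? b) ×-dec (σ ⟨$⟩ʳ b <? σ ⟨$⟩ʳ a))
                           (allPairs n))

-- the two-cycles (s , t) of ι with s < t are indexed by their smaller
-- element s, i.e. by those s with s < ι(s), where t = ι(s).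
-- twoCycleLengthSum ι = Σ_i (t_i - s_i)
twoCycleLengthSum : ∀ {n} → Permutation′ n → ℕ
twoCycleLengthSum {n} ι =
  sum (map (λ s → toℕ (ι ⟨$⟩ʳ s) ∸ toℕ s)
           (filter (λ s → s <? ι ⟨$⟩ʳ s) (allFin n)))

IsTwoCycle : ∀ {n} → Permutation′ n → Fin n → Fin n → Set
IsTwoCycle ι s t = s < t × ι ⟨$⟩ʳ s ≡ t × ι ⟨$⟩ʳ t ≡ s

module Submission where

-- Both claims rest on a local description of a 321-avoiding
-- permutation σ at a position a.  Counting the positions b ≠ a by the side of
-- a on which they lie and by whether σ(b) is smaller or larger than σ(a) gives
--   σ(a) = X + R   and   a = X + L,
-- where X, L, R count the b left of a with smaller value, left of a with larger
-- value, and right of a with smaller value.  A b counted by L and a c counted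
-- by R would form a 321-pattern b < a < c, so L = 0 or R = 0; either way the
-- number R of inversions starting at a equals σ(a) ∸ a.  Summing over a gives
-- inv(σ) = Σ_a (σ(a) ∸ a), the total size of the excedances of σ, which for an
-- involution is the sum of t − s over its two-cycles (s , t).

open import Defs
open import Data.Nat using (ℕ; zero; suc; _+_; _∸_)
import Data.Nat.Properties as ℕ
open import Data.Nat.ListAction using () renaming (sum to sumList)
open import Data.Fin using (Fin; toℕ; _<_; _<?_)
import Data.Fin.Properties as Fin
open import Data.Fin.Permutation using (Permutation′; _⟨$⟩ʳ_)
open import Data.Bool using (true; false; if_then_else_)
open import Data.List using (List; []; _∷_; _++_; tabulate; allFin; concatMap; map; filter; length)
import Data.List.Properties as List
open import Data.Product using (_×_; _,_; proj₁; proj₂; uncurry; ∃-syntax)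
open import Data.Sum using (_⊎_; inj₁; inj₂)
open import Data.Empty using (⊥-elim)
open import Function using (_∘_)
open import Function.Bundles using (Injection)
open import Function.Properties.Inverse using (Inverse⇒Injection)
open import Relation.Nullary using (Dec; yes; no; does; ¬_)
open import Relation.Nullary.Decidable using (_×-dec_)
open import Level using (0ℓ)
open import Relation.Unary using (Pred; Decidable)
open import Relation.Binary using (tri<; tri≈; tri>)
open import Relation.Binary.PropositionalEquality
  using (_≡_; _≢_; refl; sym; trans; cong; cong₂; subst; module ≡-Reasoning)
open import Algebra.Properties.CommutativeMonoid.Sum ℕ.+-0-commutativeMonoid
  using (sum-cong-≗; sum-permute; ∑-distrib-+) renaming (sum to ∑)

-- The indicator of a decided proposition.  Defining it through 'does' makes it
-- invariant under 'map′', so e.g. 𝟙 (suc c <? suc v) reduces to 𝟙 (c <? v).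
𝟙 : ∀ {p} {P : Set p} → Dec P → ℕ
𝟙 P? = if does P? then 1 else 0

𝟙-split : ∀ {p q r} {P : Set p} {Q : Set q} {R : Set r}
  (P? : Dec P) (Q? : Dec Q) (R? : Dec R) →
  (P → Q ⊎ R) → (Q → P) → (R → P) → (Q → ¬ R) → 𝟙 P? ≡ 𝟙 Q? + 𝟙 R?
𝟙-split (yes p) (yes q) (yes r) cover Q⇒P R⇒P excl = ⊥-elim (excl q r)
𝟙-split (yes p) (yes q) (no ¬r) cover Q⇒P R⇒P excl = refl
𝟙-split (yes p) (no ¬q) (yes r) cover Q⇒P R⇒P excl = refl
𝟙-split (yes p) (no ¬q) (no ¬r) cover Q⇒P R⇒P excl with cover p
... | inj₁ q = ⊥-elim (¬q q)
... | inj₂ r = ⊥-elim (¬r r)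
𝟙-split (no ¬p) (yes q) R? cover Q⇒P R⇒P excl = ⊥-elim (¬p (Q⇒P q))
𝟙-split (no ¬p) (no ¬q) (yes r) cover Q⇒P R⇒P excl = ⊥-elim (¬p (R⇒P r))
𝟙-split (no ¬p) (no ¬q) (no ¬r) cover Q⇒P R⇒P excl = refl

count : ∀ {n p} {P : Pred (Fin n) p} → Decidable P → ℕ
count P? = ∑ (λ i → 𝟙 (P? i))

count-none : ∀ {n p} {P : Pred (Fin n) p} (P? : Decidable P) →
  (∀ i → ¬ P i) → count P? ≡ 0
count-none {zero} P? none = refl
count-none {suc n} P? none with P? Fin.zero
... | yes p = ⊥-elim (none Fin.zero p)
... | no _ = count-none (P? ∘ Fin.suc) (none ∘ Fin.suc)

count-split : ∀ {n p q r} {P : Pred (Fin n) p} {Q : Pred (Fin n) q} {R : Pred (Fin n) r}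
  (P? : Decidable P) (Q? : Decidable Q) (R? : Decidable R) →
  (∀ {i} → P i → Q i ⊎ R i) → (∀ {i} → Q i → P i) → (∀ {i} → R i → P i) →
  (∀ {i} → Q i → ¬ R i) → count P? ≡ count Q? + count R?
count-split P? Q? R? cover Q⇒P R⇒P excl =
  trans (sum-cong-≗ (λ i → 𝟙-split (P? i) (Q? i) (R? i) cover Q⇒P R⇒P excl))
        (∑-distrib-+ (λ i → 𝟙 (Q? i)) (λ i → 𝟙 (R? i)))

count-permute : ∀ {n p} {P : Pred (Fin n) p} (P? : Decidable P) (π : Permutation′ n) →
  count P? ≡ count (P? ∘ (π ⟨$⟩ʳ_))
count-permute P? π = sum-permute (λ i → 𝟙 (P? i)) π

count-below : ∀ {n} (v : Fin n) → count {n} (_<? v) ≡ toℕ v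
count-below {suc n} Fin.zero = count-none {suc n} (_<? Fin.zero {n}) (λ i ())
count-below {suc n} (Fin.suc v) = cong suc (count-below v)

≢⇒<⊎> : ∀ {n} {x y : Fin n} → x ≢ y → x < y ⊎ y < x
≢⇒<⊎> {x = x} {y} x≢y with Fin.<-cmp x y
... | tri< x<y _ _ = inj₁ x<y
... | tri≈ _ x≡y _ = ⊥-elim (x≢y x≡y)
... | tri> _ _ y<x = inj₂ y<x

length-filter : ∀ {a p} {A : Set a} {P : Pred A p} (P? : Decidable P) (xs : List A) →
  length (filter P? xs) ≡ sumList (map (λ x → 𝟙 (P? x)) xs)
length-filter P? [] = refl
length-filter P? (x ∷ xs) with does (P? x)
... | true = cong suc (length-filter P? xs)
... | false = length-filter P? xs

length-filter-concatMap : ∀ {a b p} {A : Set a} {B : Set b} {P : Pred B p}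
  (P? : Decidable P) (f : A → List B) (xs : List A) →
  length (filter P? (concatMap f xs)) ≡ sumList (map (λ x → length (filter P? (f x))) xs)
length-filter-concatMap P? f [] = refl
length-filter-concatMap P? f (x ∷ xs) = begin
  length (filter P? (f x ++ concatMap f xs))
    ≡⟨ cong length (List.filter-++ P? (f x) (concatMap f xs)) ⟩
  length (filter P? (f x) ++ filter P? (concatMap f xs))
    ≡⟨ List.length-++ (filter P? (f x)) ⟩
  length (filter P? (f x)) + length (filter P? (concatMap f xs))
    ≡⟨ cong (length (filter P? (f x)) +_) (length-filter-concatMap P? f xs) ⟩
  length (filter P? (f x)) + sumList (map (λ y → length (filter P? (f y))) xs) ∎
  where open ≡-Reasoning

sumList-map-filter : ∀ {a p} {A : Set a} {P : Pred A p} (P? : Decidable P) (g : A → ℕ) →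
  (∀ x → ¬ P x → g x ≡ 0) → (xs : List A) →
  sumList (map g (filter P? xs)) ≡ sumList (map g xs)
sumList-map-filter P? g vanish [] = refl
sumList-map-filter P? g vanish (x ∷ xs) with P? x
... | yes _ = cong (g x +_) (sumList-map-filter P? g vanish xs)
... | no ¬p = begin
  sumList (map g (filter P? xs)) ≡⟨ sumList-map-filter P? g vanish xs ⟩
  sumList (map g xs)             ≡⟨ cong (_+ sumList (map g xs)) (sym (vanish x ¬p)) ⟩
  g x + sumList (map g xs)       ∎
  where open ≡-Reasoning

sumList-allFin : ∀ {n} (g : Fin n → ℕ) → sumList (map g (allFin n)) ≡ ∑ g
sumList-allFin g = trans (cong sumList (List.map-tabulate (λ i → i) g)) (sum-tabulate g)
  where
  sum-tabulate : ∀ {m} (h : Fin m → ℕ) → sumList (tabulate h) ≡ ∑ h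
  sum-tabulate {zero} h = refl
  sum-tabulate {suc m} h = cong (h Fin.zero +_) (sum-tabulate (h ∘ Fin.suc))

module Rank {n} (σ : Permutation′ n) where

  injective : ∀ {x y} → σ ⟨$⟩ʳ x ≡ σ ⟨$⟩ʳ y → x ≡ y
  injective = Injection.injective (Inverse⇒Injection σ)

  SmallerBefore LargerBefore SmallerAfter : Fin n → Pred (Fin n) 0ℓ
  SmallerBefore a b = b < a × σ ⟨$⟩ʳ b < σ ⟨$⟩ʳ a
  LargerBefore a b = b < a × σ ⟨$⟩ʳ a < σ ⟨$⟩ʳ b
  SmallerAfter a b = a < b × σ ⟨$⟩ʳ b < σ ⟨$⟩ʳ a

  smallerBefore? : ∀ a → Decidable (SmallerBefore a)
  smallerBefore? a b = (b <? a) ×-dec (σ ⟨$⟩ʳ b <? σ ⟨$⟩ʳ a)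
  largerBefore? : ∀ a → Decidable (LargerBefore a)
  largerBefore? a b = (b <? a) ×-dec (σ ⟨$⟩ʳ a <? σ ⟨$⟩ʳ b)
  smallerAfter? : ∀ a → Decidable (SmallerAfter a)
  smallerAfter? a b = (a <? b) ×-dec (σ ⟨$⟩ʳ b <? σ ⟨$⟩ʳ a)

  smallerBefore largerBefore smallerAfter : Fin n → ℕ
  smallerBefore a = count (smallerBefore? a)
  largerBefore a = count (largerBefore? a)
  smallerAfter a = count (smallerAfter? a)

  -- σ(a) counts the values below it, i.e. the positions b with σ(b) < σ(a),
  -- which lie either left or right of a.
  value-rank : ∀ a → toℕ (σ ⟨$⟩ʳ a) ≡ smallerBefore a + smallerAfter a
  value-rank a = begin
    toℕ (σ ⟨$⟩ʳ a)                    ≡⟨ count-below (σ ⟨$⟩ʳ a) ⟨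
    count {n} (_<? σ ⟨$⟩ʳ a)          ≡⟨ count-permute (_<? σ ⟨$⟩ʳ a) σ ⟩
    count (λ b → σ ⟨$⟩ʳ b <? σ ⟨$⟩ʳ a)
      ≡⟨ count-split (λ b → σ ⟨$⟩ʳ b <? σ ⟨$⟩ʳ a) (smallerBefore? a) (smallerAfter? a)
                     side proj₂ proj₂ opposite ⟩
    smallerBefore a + smallerAfter a  ∎
    where
    open ≡-Reasoning
    side : ∀ {b} → σ ⟨$⟩ʳ b < σ ⟨$⟩ʳ a → SmallerBefore a b ⊎ SmallerAfter a b
    side σb<σa with ≢⇒<⊎> (λ { refl → Fin.<-irrefl refl σb<σa })
    ... | inj₁ b<a = inj₁ (b<a , σb<σa)
    ... | inj₂ a<b = inj₂ (a<b , σb<σa)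
    opposite : ∀ {b} → SmallerBefore a b → ¬ SmallerAfter a b
    opposite (b<a , _) (a<b , _) = Fin.<-asym b<a a<b

  -- a counts the positions left of it, whose values are smaller or larger.
  position-rank : ∀ a → toℕ a ≡ smallerBefore a + largerBefore a
  position-rank a = begin
    toℕ a                            ≡⟨ count-below a ⟨
    count {n} (_<? a)
      ≡⟨ count-split (_<? a) (smallerBefore? a) (largerBefore? a) compare proj₁ proj₁ opposite ⟩
    smallerBefore a + largerBefore a ∎
    where
    open ≡-Reasoning
    compare : ∀ {b} → b < a → SmallerBefore a b ⊎ LargerBefore a b
    compare b<a with ≢⇒<⊎> (λ σb≡σa → Fin.<-irrefl (injective σb≡σa) b<a)
    ... | inj₁ σb<σa = inj₁ (b<a , σb<σa)
    ... | inj₂ σa<σb = inj₂ (b<a , σa<σb)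
    opposite : ∀ {b} → SmallerBefore a b → ¬ LargerBefore a b
    opposite (_ , σb<σa) (_ , σa<σb) = Fin.<-asym σb<σa σa<σb

  -- A larger value left of a and a smaller value right of a form a 321.
  no-321-through : Avoids321 σ → ∀ a → largerBefore a ≡ 0 ⊎ smallerAfter a ≡ 0
  no-321-through avoids a with Fin.any? (largerBefore? a)
  ... | no none = inj₁ (count-none (largerBefore? a) (λ b p → none (b , p)))
  ... | yes (b , b<a , σa<σb) with Fin.any? (smallerAfter? a)
  ...   | no none = inj₂ (count-none (smallerAfter? a) (λ c p → none (c , p)))
  ...   | yes (c , a<c , σc<σa) = ⊥-elim (avoids (b , a , c , b<a , a<c , σa<σb , σc<σa))

  smallerAfter-excedance : Avoids321 σ → ∀ a → smallerAfter a ≡ toℕ (σ ⟨$⟩ʳ a) ∸ toℕ a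
  smallerAfter-excedance avoids a = begin
    smallerAfter a
      ≡⟨ cancel (smallerBefore a) (no-321-through avoids a) ⟩
    (smallerBefore a + smallerAfter a) ∸ (smallerBefore a + largerBefore a)
      ≡⟨ cong₂ _∸_ (value-rank a) (position-rank a) ⟨
    toℕ (σ ⟨$⟩ʳ a) ∸ toℕ a ∎
    where
    open ≡-Reasoning
    cancel : ∀ x {l r} → l ≡ 0 ⊎ r ≡ 0 → r ≡ (x + r) ∸ (x + l)
    cancel x {l} {r} l0∨r0 = trans (r∸l l0∨r0) (sym (ℕ.[m+n]∸[m+o]≡n∸o x r l))
      where
      r∸l : l ≡ 0 ⊎ r ≡ 0 → r ≡ r ∸ l
      r∸l (inj₁ refl) = refl
      r∸l (inj₂ refl) = sym (ℕ.0∸n≡0 l)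

inv-by-start : ∀ {n} (σ : Permutation′ n) → inv σ ≡ ∑ (Rank.smallerAfter σ)
inv-by-start {n} σ = begin
  length (filter IsInversion? (concatMap row (allFin n)))
    ≡⟨ length-filter-concatMap IsInversion? row (allFin n) ⟩
  sumList (map (λ a → length (filter IsInversion? (row a))) (allFin n))
    ≡⟨ sumList-allFin (λ a → length (filter IsInversion? (row a))) ⟩
  ∑ (λ a → length (filter IsInversion? (row a)))
    ≡⟨ sum-cong-≗ row-count ⟩
  ∑ (Rank.smallerAfter σ) ∎
  where
  open ≡-Reasoning
  IsInversion? : Decidable (uncurry (IsInversion σ))
  IsInversion? (a , b) = (a <? b) ×-dec (σ ⟨$⟩ʳ b <? σ ⟨$⟩ʳ a)
  row : Fin n → List (Fin n × Fin n)
  row a = map (a ,_) (allFin n)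
  row-count : ∀ a → length (filter IsInversion? (row a)) ≡ Rank.smallerAfter σ a
  row-count a = begin
    length (filter IsInversion? (row a))
      ≡⟨ length-filter IsInversion? (row a) ⟩
    sumList (map (λ p → 𝟙 (IsInversion? p)) (map (a ,_) (allFin n)))
      ≡⟨ cong sumList (List.map-∘ (allFin n)) ⟨
    sumList (map (λ b → 𝟙 (IsInversion? (a , b))) (allFin n))
      ≡⟨ sumList-allFin (λ b → 𝟙 (IsInversion? (a , b))) ⟩
    Rank.smallerAfter σ a ∎

-- twoCycleLengthSum σ, read for an arbitrary permutation, is the total size
-- Σ_s (σ(s) ∸ s) of its excedances: the non-excedances contribute 0 anyway.
twoCycleLengthSum-as-sum : ∀ {n} (σ : Permutation′ n) →
  twoCycleLengthSum σ ≡ ∑ (λ s → toℕ (σ ⟨$⟩ʳ s) ∸ toℕ s)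
twoCycleLengthSum-as-sum {n} σ =
  trans (sumList-map-filter (λ s → s <? σ ⟨$⟩ʳ s) excess vanish (allFin n))
        (sumList-allFin excess)
  where
  excess : Fin n → ℕ
  excess s = toℕ (σ ⟨$⟩ʳ s) ∸ toℕ s
  vanish : ∀ s → ¬ s < σ ⟨$⟩ʳ s → excess s ≡ 0
  vanish s s≮σs = ℕ.m≤n⇒m∸n≡0 (ℕ.≮⇒≥ s≮σs)

inv-321-avoiding : ∀ {n} (σ : Permutation′ n) → Avoids321 σ → inv σ ≡ twoCycleLengthSum σ
inv-321-avoiding σ avoids = begin
  inv σ                                  ≡⟨ inv-by-start σ ⟩
  ∑ (Rank.smallerAfter σ)                ≡⟨ sum-cong-≗ (Rank.smallerAfter-excedance σ avoids) ⟩
  ∑ (λ s → toℕ (σ ⟨$⟩ʳ s) ∸ toℕ s)      ≡⟨ twoCycleLengthSum-as-sum σ ⟨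
  twoCycleLengthSum σ                    ∎
  where open ≡-Reasoning

-- In a 321-avoiding involution an inversion (a , b) starts at the smaller
-- element a < ι(a) of a two-cycle: otherwise ι(a) ≤ a yields a 321-pattern.
inversion-start : ∀ {n} (ι : Permutation′ n) → IsInvolution ι → Avoids321 ι →
  ∀ {a b} → IsInversion ι a b → ∃[ t ] IsTwoCycle ι a t
inversion-start ι involution avoids {a} {b} (a<b , ιb<ιa) with Fin.<-cmp (ι ⟨$⟩ʳ a) a
... | tri< ιa<a _ _ =
  ⊥-elim (avoids (ι ⟨$⟩ʳ a , a , b , ιa<a , a<b ,
                  subst (ι ⟨$⟩ʳ a <_) (sym (involution a)) ιa<a , ιb<ιa))
... | tri≈ _ ιa≡a _ =
  ⊥-elim (avoids (ι ⟨$⟩ʳ b , a , b , subst (ι ⟨$⟩ʳ b <_) ιa≡a ιb<ιa , a<b ,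
                  subst (_< ι ⟨$⟩ʳ (ι ⟨$⟩ʳ b)) (sym ιa≡a)
                        (subst (a <_) (sym (involution b)) a<b) , ιb<ιa))
... | tri> _ _ a<ιa = ι ⟨$⟩ʳ a , a<ιa , refl , involution a

inversion-end : ∀ {n} (ι : Permutation′ n) → IsInvolution ι → Avoids321 ι →
  ∀ {a b} → IsInversion ι a b → ∃[ s ] IsTwoCycle ι s b
inversion-end ι involution avoids {a} {b} (a<b , ιb<ιa) with Fin.<-cmp (ι ⟨$⟩ʳ b) b
... | tri< ιb<b _ _ = ι ⟨$⟩ʳ b , ιb<b , involution b , refl
... | tri≈ _ ιb≡b _ =
  ⊥-elim (avoids (a , b , ι ⟨$⟩ʳ a , a<b , subst (_< ι ⟨$⟩ʳ a) ιb≡b ιb<ιa , ιb<ιa ,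
                  subst (_< ι ⟨$⟩ʳ b) (sym (involution a))
                        (subst (a <_) (sym ιb≡b) a<b)))
... | tri> _ _ b<ιb =
  ⊥-elim (avoids (a , b , ι ⟨$⟩ʳ b , a<b , b<ιb , ιb<ιa ,
                  subst (_< ι ⟨$⟩ʳ b) (sym (involution b)) b<ιb))

lemma3p13 : (n : ℕ) (ι : Permutation′ n) → IsInvolution ι → Avoids321 ι →
    ((a b : Fin n) → IsInversion ι a b →
      (∃[ t ] IsTwoCycle ι a t) × (∃[ s ] IsTwoCycle ι s b))
    × inv ι ≡ twoCycleLengthSum ι
lemma3p13 n ι involution avoids =
  (λ a b inversion → inversion-start ι involution avoids inversion ,
                     inversion-end ι involution avoids inversion) ,
  inv-321-avoiding ι avoids
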